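{- For every Turing machine $T=(\Lambda,S,\Delta)$ (with $s_0$ not in the image of $\Delta_2$), the formula $\phi_T$ of $\mathcal{L}_\mathit{AAULC}$ is satisfiable, i.e. there exist a model $\mathcal{M}$ and a world $w$ of $\mathcal{M}$ with $\mathcal{M},w\models\phi_T$.
   Context: Logic AAULC. Fix a countable set $\mathcal{P}$ of propositional atoms and a finite set $\mathcal{A}$ of agents containing five distinct agents $a,\mathit{left},\mathit{right},\mathit{up},\mathit{down}$. The language $\mathcal{L}_\mathit{AAULC}$ is $\phi ::= p \mid \neg\phi \mid \phi\vee\phi \mid \square_x\phi \mid C\phi \mid [U]\phi \mid [\forall]\phi$ with $p\in\mathcal{P}$, $x\in\mathcal{A}$, where an arrow update $U$ is a finite set of clauses $(\phi_1,x,\phi_2)$ with $\phi_1,\phi_2$ formulas and $x\in\mathcal{A}$. $\mathcal{L}_\mathit{AULC}$ is the fragment without $[\forall]$ (also inside updates). $\wedge,\rightarrow,\top,\bot,\lozenge_x=\neg\square_x\neg$ are the usual abbreviations. A model is $\mathcal{M}=(W,R,V)$ with $W$ a set, $R(x)\subseteq W\times W$ an arbitrary relation for each $x\in\mathcal{A}$, $V:\mathcal{P}\to 2^W$. Semantics: Booleans and atoms as usual; $\mathcal{M},w\models\square_x\phi$ iff $\phi$ holds at all $R(x)$-successors of $w$; $\mathcal{M},w\models C\phi$ iff $\phi$ holds at every world reachable from $w$ by a finite path of length $\geq 1$ whose steps are in $\bigcup_{x\in\mathcal{A}}R(x)$; $\mathcal{M},w\models[U]\phi$ iff $\mathcal{M}*U,w\models\phi$,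 where $\mathcal{M}*U=(W,R*U,V)$ and $R*U(x)=\{(w_1,w_2)\in R(x)\mid \exists(\phi_1,x,\phi_2)\in U:\ \mathcal{M},w_1\models\phi_1,\ \mathcal{M},w_2\models\phi_2\}$; $\mathcal{M},w\models[\forall]\phi$ iff $\mathcal{M},w\models[U]\phi$ for every arrow update $U$ all of whose formulas lie in $\mathcal{L}_\mathit{AULC}$. Turing machines. A Turing machine is $T=(\Lambda,S,\Delta)$ with $\Lambda$ a finite alphabet containing $\alpha_0$, $S$ a finite set of states containing $s_0,s_\mathit{end}$, and $\Delta:\Lambda\times S\to\Lambda\times S\times\{\mathit{left},\mathit{remain},\mathit{right}\}$; $\Delta_1,\Delta_2,\Delta_3$ are its components (symbol written, next state, head move). It is assumed that $s_0$ never re-occurs, i.e. $s_0\notin$ image of $\Delta_2$. Let $s_\mathit{void}$ be a fresh state symbol not in $S$; put $\mathit{states}=S\cup\{s_\mathit{void}\}$, $\mathit{symbols}=\Lambda$. Assume the elements of $\mathit{states}$, $\Lambda$ and three further symbols $\mathit{pos},\mathit{lpos},\mathit{rpos}$ are pairwise distinct atoms in $\mathcal{P}$. The formula $\phi_T := C\psi_\mathit{grid}\wedge C\psi_\mathit{sane}\wedge C\psi_T\wedge s_0\wedge\mathit{pos}$, where: $D=\{\mathit{left},\mathit{right},\mathit{up},\mathit{down}\}$; $\mathit{INV}=\{(\mathit{left},\mathit{right}),(\mathit{right},\mathit{left}),(\mathit{up},\mathit{down}),(\mathit{down},\mathit{up})\}$; $\mathit{COMM}=(\{\mathit{up},\mathit{down}\}\times\{\mathit{left},\mathit{right}\})\cup(\{\mathit{left},\mathit{right}\}\times\{\mathit{up},\mathit{down}\})$;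 $\psi_\mathit{grid}=\mathit{ref}_a\wedge\mathit{no\_other}\wedge\mathit{direction}\wedge\mathit{inverse}\wedge\mathit{commute}$ with $\mathit{ref}_a=\lozenge_a\top\wedge[\forall]\square_a\lozenge_a\top$; $\mathit{no\_other}=\bigwedge_{x\in\mathcal{A}\setminus(D\cup\{a\})}\square_x\bot$; $\mathit{direction}=\bigwedge_{x\in D}(\lozenge_x\top\wedge[\forall](\lozenge_x\lozenge_a\top\rightarrow\square_x\lozenge_a\top))$; $\mathit{inverse}=[\forall](\lozenge_a\top\rightarrow\bigwedge_{(x,y)\in\mathit{INV}}\square_x\square_y\lozenge_a\top)$; $\mathit{commute}=[\forall]\bigwedge_{(x,y)\in\mathit{COMM}}(\lozenge_x\lozenge_y\lozenge_a\top\rightarrow\square_y\square_x\lozenge_a\top)$. $\psi_\mathit{sane}$ is the conjunction of: $\neg(\mathit{pos}\wedge\mathit{lpos})\wedge\neg(\mathit{pos}\wedge\mathit{rpos})\wedge\neg(\mathit{rpos}\wedge\mathit{lpos})$; $((\mathit{pos}\vee\mathit{rpos})\rightarrow\square_\mathit{right}\mathit{rpos})\wedge((\mathit{pos}\vee\mathit{lpos})\rightarrow\square_\mathit{left}\mathit{lpos})$; $\bigvee_{s\in\mathit{states}}(s\wedge\bigwedge_{s'\in\mathit{states}\setminus\{s\}}\neg s')$; $\bigwedge_{s\in\mathit{states}}(s\rightarrow(\square_\mathit{left}s\wedge\square_\mathit{right}s))$; $\bigvee_{\alpha\in\Lambda}(\alpha\wedge\bigwedge_{\beta\in\Lambda\setminus\{\alpha\}}\neg\beta)$;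 $(s_0\vee s_\mathit{void})\rightarrow\square_\mathit{down}s_\mathit{void}$; $s_0\rightarrow\alpha_0$; $\bigwedge_{\alpha\in\Lambda}((\neg\mathit{pos}\wedge\alpha)\rightarrow\square_\mathit{up}\alpha)$. $\psi_T$ is the conjunction of: for all $(\alpha,s)\in\Lambda\times S$ with $\Delta_3(\alpha,s)=\mathit{left}$: $(\mathit{pos}\wedge s\wedge\alpha)\rightarrow\square_\mathit{up}\square_\mathit{left}\mathit{pos}$; with $\Delta_3(\alpha,s)=\mathit{right}$: $(\mathit{pos}\wedge s\wedge\alpha)\rightarrow\square_\mathit{up}\square_\mathit{right}\mathit{pos}$; with $\Delta_3(\alpha,s)=\mathit{remain}$: $(\mathit{pos}\wedge s\wedge\alpha)\rightarrow\square_\mathit{up}\mathit{pos}$; for all $(\alpha,s)$: $(\mathit{pos}\wedge s\wedge\alpha)\rightarrow\square_\mathit{up}\Delta_2(\alpha,s)$ and $(\mathit{pos}\wedge s\wedge\alpha)\rightarrow\square_\mathit{up}\Delta_1(\alpha,s)$. -}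

module Defs where

open import Data.Nat using (ℕ)
open import Data.Fin using (Fin) renaming (_≟_ to _≟F_)
open import Data.Bool using (Bool; true)
open import Data.Maybe using (Maybe; just; nothing)
open import Data.Maybe.Properties using (≡-dec)
open import Data.List using (List; []; _∷_; _++_; map; foldr; filter; allFin; concatMap)
open import Data.Product using (Σ; _×_; _,_; proj₁; proj₂)
open import Data.Sum using (_⊎_)
open import Data.Empty using (⊥)
open import Relation.Nullary using (¬_; ¬?)
open import Relation.Binary.PropositionalEquality using (_≡_)
open import Relation.Binary.Construct.Closure.Transitive using (TransClosure)

module Logic (Agent : Set) (Atom : Set) where

  infixr 5 _∨'_

  mutual
    data FormU : Set where
      atomU : Atom → FormU
      negU  : FormU → FormU
      orU   : FormU → FormU → FormU
      boxU  : Agent → FormU → FormU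
      CU    : FormU → FormU
      updU  : List ClauseU → FormU → FormU

    data ClauseU : Set where
      clU : FormU → Agent → FormU → ClauseU

  mutual
    data Form : Set where
      atom : Atom → Form
      ¬'_  : Form → Form
      _∨'_ : Form → Form → Form
      □    : Agent → Form → Form
      C    : Form → Form
      [_]_ : List Clause → Form → Form
      [∀]_ : Form → Form

    data Clause : Set where
      cl : Form → Agent → Form → Clause

  record Model : Set₁ where
    field
      W : Set
      R : Agent → W → W → Set
      V : Atom → W → Bool

  open Model

  Step : (M : Model) → W M → W M → Set
  Step M u v = Σ Agent λ x → R M x u v

  restrict : (M : Model) → (Agent → W M → W M → Set) → Model
  restrict M Q = record { W = W M ; R = λ x w₁ w₂ → R M x w₁ w₂ × Q x w₁ w₂ ; V = V M }

  -- Semantics (metatheory read classically: disjunction is given its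
  -- classical, double-negated meaning).
  mutual
    satU : (M : Model) → FormU → W M → Set
    satU M (atomU p) w = V M p w ≡ true
    satU M (negU φ) w = ¬ satU M φ w
    satU M (orU φ ψ) w = ¬ ((¬ satU M φ w) × (¬ satU M ψ w))
    satU M (boxU x φ) w = ∀ v → R M x w v → satU M φ v
    satU M (CU φ) w = ∀ v → TransClosure (Step M) w v → satU M φ v
    satU M (updU U φ) w = satU (restrict M (clausesU M U)) φ w

    clausesU : (M : Model) → List ClauseU → Agent → W M → W M → Set
    clausesU M [] x w₁ w₂ = ⊥
    clausesU M (clU φ₁ y φ₂ ∷ U) x w₁ w₂ =
      (y ≡ x × satU M φ₁ w₁ × satU M φ₂ w₂) ⊎ clausesU M U x w₁ w₂

  _*U_ : Model → List ClauseU → Model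
  M *U U = restrict M (clausesU M U)

  mutual
    _⊨_,_ : (M : Model) → Form → W M → Set
    M ⊨ atom p , w = V M p w ≡ true
    M ⊨ ¬' φ , w = ¬ (M ⊨ φ , w)
    M ⊨ φ ∨' ψ , w = ¬ ((¬ (M ⊨ φ , w)) × (¬ (M ⊨ ψ , w)))
    M ⊨ □ x φ , w = ∀ v → R M x w v → M ⊨ φ , v
    M ⊨ C φ , w = ∀ v → TransClosure (Step M) w v → M ⊨ φ , v
    M ⊨ [ U ] φ , w = restrict M (clauses M U) ⊨ φ , w
    M ⊨ [∀] φ , w = (U : List ClauseU) → (M *U U) ⊨ φ , w

    clauses : (M : Model) → List Clause → Agent → W M → W M → Set
    clauses M [] x w₁ w₂ = ⊥
    clauses M (cl φ₁ y φ₂ ∷ U) x w₁ w₂ =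
      (y ≡ x × M ⊨ φ₁ , w₁ × M ⊨ φ₂ , w₂) ⊎ clauses M U x w₁ w₂

  _*_ : Model → List Clause → Model
  M * U = restrict M (clauses M U)

data Agent (k : ℕ) : Set where
  a left right up down : Agent k
  other : Fin k → Agent k

data Move : Set where
  mleft mremain mright : Move

record TM : Set where
  field
    nΛ nS : ℕ
    α₀    : Fin nΛ
    s₀    : Fin nS
    s-end : Fin nS
    Δ     : Fin nΛ → Fin nS → Fin nΛ × Fin nS × Move

  Δ₁ : Fin nΛ → Fin nS → Fin nΛ
  Δ₁ α s = proj₁ (Δ α s)
  Δ₂ : Fin nΛ → Fin nS → Fin nS
  Δ₂ α s = proj₁ (proj₂ (Δ α s))
  Δ₃ : Fin nΛ → Fin nS → Move
  Δ₃ α s = proj₂ (proj₂ (Δ α s))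

S₀Fresh : TM → Set
S₀Fresh T = ∀ α s → ¬ (TM.Δ₂ T α s ≡ TM.s₀ T)

-- The atoms used by φ_T: states (nothing = s_void), symbols, pos, lpos, rpos.
data TMAtom (T : TM) : Set where
  st   : Maybe (Fin (TM.nS T)) → TMAtom T
  sym  : Fin (TM.nΛ T) → TMAtom T
  pos lpos rpos : TMAtom T

-- The formula φ_T.  The atom set P is ℕ; ι assigns the TM atoms to
-- (pairwise distinct, when ι is injective) atoms of P.

module Construction (k : ℕ) (T : TM) (ι : TMAtom T → ℕ) where
  open TM T
  open Logic (Agent k) ℕ

  at : TMAtom T → Form
  at t = atom (ι t)

  ⊤' : Form
  ⊤' = atom 0 ∨' (¬' atom 0)
  ⊥' : Form
  ⊥' = ¬' ⊤'
  _∧'_ : Form → Form → Form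
  φ ∧' ψ = ¬' ((¬' φ) ∨' (¬' ψ))
  _⇒_ : Form → Form → Form
  φ ⇒ ψ = (¬' φ) ∨' ψ
  ◇ : Agent k → Form → Form
  ◇ x φ = ¬' (□ x (¬' φ))

  ⋀ : List Form → Form
  ⋀ = foldr _∧'_ ⊤'
  ⋁ : List Form → Form
  ⋁ = foldr _∨'_ ⊥'

  D : List (Agent k)
  D = left ∷ right ∷ up ∷ down ∷ []
  INV : List (Agent k × Agent k)
  INV = (left , right) ∷ (right , left) ∷ (up , down) ∷ (down , up) ∷ []
  COMM : List (Agent k × Agent k)
  COMM = (up , left) ∷ (up , right) ∷ (down , left) ∷ (down , right)
       ∷ (left , up) ∷ (left , down) ∷ (right , up) ∷ (right , down) ∷ []

  ◇a⊤ : Form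
  ◇a⊤ = ◇ a ⊤'

  ref-a no-other direction inverse commute ψgrid : Form
  ref-a = ◇a⊤ ∧' ([∀] □ a ◇a⊤)
  no-other = ⋀ (map (λ i → □ (other i) ⊥') (allFin k))
  direction = ⋀ (map (λ x → ◇ x ⊤' ∧' ([∀] (◇ x ◇a⊤ ⇒ □ x ◇a⊤))) D)
  inverse = [∀] (◇a⊤ ⇒ ⋀ (map (λ xy → □ (proj₁ xy) (□ (proj₂ xy) ◇a⊤)) INV))
  commute = [∀] ⋀ (map (λ xy → ◇ (proj₁ xy) (◇ (proj₂ xy) ◇a⊤) ⇒ □ (proj₂ xy) (□ (proj₁ xy) ◇a⊤)) COMM)
  ψgrid = ref-a ∧' (no-other ∧' (direction ∧' (inverse ∧' commute)))

  states : List (Maybe (Fin nS))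
  states = nothing ∷ map just (allFin nS)
  symbols : List (Fin nΛ)
  symbols = allFin nΛ

  exactlyOneState : Form
  exactlyOneState = ⋁ (map (λ s → at (st s) ∧'
      ⋀ (map (λ s' → ¬' at (st s')) (filter (λ s' → ¬? (≡-dec _≟F_ s' s)) states))) states)

  exactlyOneSymbol : Form
  exactlyOneSymbol = ⋁ (map (λ α → at (sym α) ∧'
      ⋀ (map (λ β → ¬' at (sym β)) (filter (λ β → ¬? (β ≟F α)) symbols))) symbols)

  ψsane : Form
  ψsane = ⋀
    ( (¬' (at pos ∧' at lpos)) ∧' ((¬' (at pos ∧' at rpos)) ∧' (¬' (at rpos ∧' at lpos)))
    ∷ (((at pos ∨' at rpos) ⇒ □ right (at rpos)) ∧' ((at pos ∨' at lpos) ⇒ □ left (at lpos)))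
    ∷ exactlyOneState
    ∷ ⋀ (map (λ s → at (st s) ⇒ (□ left (at (st s)) ∧' □ right (at (st s)))) states)
    ∷ exactlyOneSymbol
    ∷ ((at (st (just s₀)) ∨' at (st nothing)) ⇒ □ down (at (st nothing)))
    ∷ (at (st (just s₀)) ⇒ at (sym α₀))
    ∷ ⋀ (map (λ α → ((¬' at pos) ∧' at (sym α)) ⇒ □ up (at (sym α))) symbols)
    ∷ [] )

  moveClause : Fin nΛ → Fin nS → Form
  moveClause α s with Δ₃ α s
  ... | mleft   = (at pos ∧' (at (st (just s)) ∧' at (sym α))) ⇒ □ up (□ left (at pos))
  ... | mright  = (at pos ∧' (at (st (just s)) ∧' at (sym α))) ⇒ □ up (□ right (at pos))
  ... | mremain = (at pos ∧' (at (st (just s)) ∧' at (sym α))) ⇒ □ up (at pos)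

  transClauses : Fin nΛ → Fin nS → Form
  transClauses α s =
    moveClause α s
    ∧' (((at pos ∧' (at (st (just s)) ∧' at (sym α))) ⇒ □ up (at (st (just (Δ₂ α s)))))
    ∧' ((at pos ∧' (at (st (just s)) ∧' at (sym α))) ⇒ □ up (at (sym (Δ₁ α s)))))

  ψT : Form
  ψT = ⋀ (concatMap (λ α → map (λ s → transClauses α s) (allFin nS)) symbols)

  φT : Form
  φT = C ψgrid ∧' (C ψsane ∧' (C ψT ∧' (at (st (just s₀)) ∧' at pos)))

-- The model is the ℤ × ℤ grid (cell, time) with left/right acting on the
-- cell, up/down on the time and a as the identity.  Every relation is the
-- graph of a bijection, and arrow updates only delete arrows, so in every
-- updated model each agent still has at most one successor; this is all the
-- [∀]-conjuncts of ψgrid ask for.  Row n ≥ 0 is labelled by the configuration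
-- of T after n steps and the rows below 0 by the void state and a blank tape,
-- which makes ψsane and ψT true everywhere; freshness of s₀ is what confines
-- s₀ to row 0.

module Submission where

open import Defs
open import Data.Empty using (⊥; ⊥-elim)
open import Data.Bool using (Bool; true) renaming (_≟_ to _≟ᵇ_)
open import Data.Fin using (Fin) renaming (_≟_ to _≟F_)
open import Data.Integer using (ℤ; +_; -[1+_]; _<_)
import Data.Integer as ℤ
import Data.Integer.Properties as ℤ
open import Data.List using (List; []; _∷_; _++_; map; filter; allFin; concatMap)
open import Data.List.Membership.Propositional using (_∈_; lose)
open import Data.List.Membership.Propositional.Properties
  using (∈-allFin; ∈-map⁺; ∈-map⁻; ∈-filter⁻; ∈-concatMap⁻; ∈-++⁺ˡ; ∈-++⁺ʳ)
open import Data.List.Relation.Unary.Any using (here; there; any?; satisfied)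
open import Data.Maybe using (Maybe; just; nothing)
open import Data.Maybe.Properties using (≡-dec; just-injective)
open import Data.Nat using (ℕ; zero; suc)
import Data.Nat as ℕ
open import Data.Product using (Σ; _×_; _,_; proj₂)
import Data.Product as Product
open import Data.Sum using (_⊎_; inj₁; inj₂)
import Data.Sum as Sum
open import Function using (_∘_)
open import Function.Definitions using (Injective)
open import Relation.Binary.Definitions using (DecidableEquality)
open import Relation.Binary.PropositionalEquality
  using (_≡_; refl; trans; cong; subst; module ≡-Reasoning)
  renaming (sym to ≡-sym)
open import Relation.Nullary using (¬_; Dec; yes; no; does; ¬?; _×-dec_)
open import Relation.Nullary.Decidable using (dec-true; decidable-stable)
open import Relation.Nullary.Negation using (Stable; negated-stable)

-- Satisfaction of ∨', ∧' and ⇒ is definitionally ∨ᶜ, ∧ᶜ and ⇒ᶜ of the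
-- components.  Lemmas are stated at this level because Agda cannot recover
-- φ and ψ from the unfolded type of M ⊨ φ ∧' ψ , w.

infixr 2 _∨ᶜ_ _∧ᶜ_ _⇒ᶜ_

_∨ᶜ_ : Set → Set → Set
A ∨ᶜ B = ¬ (¬ A × ¬ B)

_∧ᶜ_ : Set → Set → Set
A ∧ᶜ B = ¬ (¬ A ∨ᶜ ¬ B)

_⇒ᶜ_ : Set → Set → Set
A ⇒ᶜ B = ¬ A ∨ᶜ B

module _ {A B : Set} where

  infixr 4 _,ᶜ_

  ∨ᶜ-inj₁ : A → A ∨ᶜ B
  ∨ᶜ-inj₁ x (¬x , _) = ¬x x

  ∨ᶜ-inj₂ : B → A ∨ᶜ B
  ∨ᶜ-inj₂ y (_ , ¬y) = ¬y y

  ∨ᶜ-elim : Dec A → Stable B → A ∨ᶜ B → A ⊎ B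
  ∨ᶜ-elim (yes x) _        _ = inj₁ x
  ∨ᶜ-elim (no ¬x) stable-B h = inj₂ (stable-B λ ¬y → h (¬x , ¬y))

  _,ᶜ_ : A → B → A ∧ᶜ B
  x ,ᶜ y = λ ¬¬x×¬¬y → ¬¬x×¬¬y ((λ ¬x → ¬x x) , (λ ¬y → ¬y y))

  ∧ᶜ-elim : Stable A → Stable B → A ∧ᶜ B → A × B
  ∧ᶜ-elim stable-A stable-B h =
    stable-A (λ ¬x → h λ (¬¬x , _) → ¬¬x ¬x) , stable-B (λ ¬y → h λ (_ , ¬¬y) → ¬¬y ¬y)

  ⇒ᶜ-intro : (A → B) → A ⇒ᶜ B
  ⇒ᶜ-intro f (¬¬x , ¬y) = ¬¬x (¬y ∘ f)

excluded-middleᶜ : {A : Set} → A ∨ᶜ ¬ A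
excluded-middleᶜ (¬x , ¬¬x) = ¬¬x ¬x

true-stable : {b : Bool} → Stable (b ≡ true)
true-stable = decidable-stable (_ ≟ᵇ true)

does-true⇒ : {A : Set} (a? : Dec A) → does a? ≡ true → A
does-true⇒ (yes x) _  = x
does-true⇒ (no _)  ()

i<suc[i] : ∀ i → i < ℤ.suc i
i<suc[i] i = ℤ.suc[i]≤j⇒i<j ℤ.≤-refl

pred[i]<i : ∀ i → ℤ.pred i < i
pred[i]<i i = ℤ.i≤pred[j]⇒i<j ℤ.≤-refl

module Validity (k : ℕ) (T : TM) (ι : TMAtom T → ℕ) where
  open Logic (Agent k) ℕ
  open Model
  open Construction k T ι

  module _ {M : Model} {w : W M} where

    ⋀-intro : ∀ φs → (∀ {φ} → φ ∈ φs → M ⊨ φ , w) → M ⊨ ⋀ φs , w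
    ⋀-intro []       _ = excluded-middleᶜ
    ⋀-intro (φ ∷ φs) h = h (here refl) ,ᶜ ⋀-intro φs (h ∘ there)

    ⋀-map-intro : ∀ {A : Set} (g : A → Form) xs → (∀ x → M ⊨ g x , w) → M ⊨ ⋀ (map g xs) , w
    ⋀-map-intro g xs h = ⋀-intro (map g xs) λ φ∈ → let (x , _ , φ≡gx) = ∈-map⁻ g φ∈ in
      subst (λ φ → M ⊨ φ , w) (≡-sym φ≡gx) (h x)

    ⋁-intro : ∀ {φ} φs → φ ∈ φs → M ⊨ φ , w → M ⊨ ⋁ φs , w
    ⋁-intro (_ ∷ _)  (here refl) h = ∨ᶜ-inj₁ h
    ⋁-intro (_ ∷ φs) (there φ∈)  h = ∨ᶜ-inj₂ (⋁-intro φs φ∈ h)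

    exactly-one-intro : ∀ {A : Set} (_≟_ : DecidableEquality A) (p : A → Form) xs x → x ∈ xs →
      M ⊨ p x , w → (∀ y → M ⊨ p y , w → y ≡ x) →
      M ⊨ ⋁ (map (λ x → p x ∧' ⋀ (map (λ y → ¬' p y) (filter (λ y → ¬? (y ≟ x)) xs))) xs) , w
    exactly-one-intro _≟_ p xs x x∈xs px unique =
      ⋁-intro _ (∈-map⁺ _ x∈xs) (px ,ᶜ ⋀-intro _ others)
      where
      others : ∀ {φ} → φ ∈ map (λ y → ¬' p y) (filter (λ y → ¬? (y ≟ x)) xs) → M ⊨ φ , w
      others φ∈ with ∈-map⁻ (λ y → ¬' p y) φ∈
      ... | y , y∈ , refl = λ py → proj₂ (∈-filter⁻ (λ y → ¬? (y ≟ x)) {xs = xs} y∈) (unique y py)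

  ◇⊤-intro : ∀ M {x w v} → R M x w v → M ⊨ ◇ x ⊤' , w
  ◇⊤-intro M {v = v} r no-successor = no-successor v r excluded-middleᶜ

  FollowsShift : (M : Model) → (Agent k → W M → W M) → Set
  FollowsShift M f = ∀ x {w v} → R M x w v → v ≡ f x w

  module _ (M : Model) {f : Agent k → W M → W M} (follows : FollowsShift M f) where

    *U-followsShift : ∀ U → FollowsShift (M *U U) f
    *U-followsShift U x (r , _) = follows x r

    □◇⊤-of-fixed : ∀ x w → f x w ≡ w → M ⊨ □ x (◇ x ⊤') , w
    □◇⊤-of-fixed x w fixed v r = ◇⊤-intro M (subst (λ u → R M x u v) v≡w r)
      where
      v≡w : w ≡ v
      v≡w = ≡-sym (trans (follows x r) fixed)

    ◇⇒□ : ∀ x φ w → M ⊨ ◇ x φ ⇒ □ x φ , w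
    ◇⇒□ x φ w (¬¬◇φ , ¬□φ) = ¬¬◇φ λ ◇φ → ◇φ λ v r φv → ¬□φ λ v′ r′ →
      subst (λ u → M ⊨ φ , u) (trans (follows x r) (≡-sym (follows x r′))) φv

    □□-of-inverse : ∀ x y φ w → f y (f x w) ≡ w → M ⊨ φ , w → M ⊨ □ x (□ y φ) , w
    □□-of-inverse x y φ w inverse φw v r u r′ = subst (λ u → M ⊨ φ , u) w≡u φw
      where
      open ≡-Reasoning
      w≡u : w ≡ u
      w≡u = ≡-sym (begin
        u           ≡⟨ follows y r′ ⟩
        f y v       ≡⟨ cong (f y) (follows x r) ⟩
        f y (f x w) ≡⟨ inverse ⟩
        w           ∎)

    ◇◇⇒□□-of-commuting : ∀ x y φ w → f y (f x w) ≡ f x (f y w) → M ⊨ ◇ x (◇ y φ) ⇒ □ y (□ x φ) , w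
    ◇◇⇒□□-of-commuting x y φ w commute (¬¬◇◇φ , ¬□□φ) =
      ¬¬◇◇φ λ ◇◇φ → ◇◇φ λ v r ¬◇φ → ¬◇φ λ u r′ φu → ¬□□φ λ v′ r″ u′ r‴ →
        subst (λ z → M ⊨ φ , z) (u≡u′ r r′ r″ r‴) φu
      where
      open ≡-Reasoning
      u≡u′ : ∀ {v u v′ u′} → R M x w v → R M y v u → R M y w v′ → R M x v′ u′ → u ≡ u′
      u≡u′ {v} {u} {v′} {u′} r r′ r″ r‴ = begin
        u           ≡⟨ follows y r′ ⟩
        f y v       ≡⟨ cong (f y) (follows x r) ⟩
        f y (f x w) ≡⟨ commute ⟩
        f x (f y w) ≡⟨ cong (f x) (follows y r″) ⟨
        f x v′      ≡⟨ follows x r‴ ⟨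
        u′          ∎

module Grid (k : ℕ) where
  open Logic (Agent k) ℕ

  Cell : Set
  Cell = ℤ × ℤ

  shift : Agent k → Cell → Cell
  shift left  (i , t) = ℤ.pred i , t
  shift right (i , t) = ℤ.suc i , t
  shift up    (i , t) = i , ℤ.suc t
  shift down  (i , t) = i , ℤ.pred t
  shift _     c       = c

  Arrow : Agent k → Cell → Cell → Set
  Arrow (other _) _ _ = ⊥
  Arrow x         c d = d ≡ shift x c

  grid : (ℕ → Cell → Bool) → Model
  grid V = record { W = Cell ; R = Arrow ; V = V }

  arrow-follows : ∀ x {c d} → Arrow x c d → d ≡ shift x c
  arrow-follows a     e = e
  arrow-follows left  e = e
  arrow-follows right e = e
  arrow-follows up    e = e
  arrow-follows down  e = e

  module _ (T : TM) (ι : TMAtom T → ℕ) (V : ℕ → Cell → Bool) where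
    open Construction k T ι
    open Validity k T ι

    M : Model
    M = grid V

    follows : ∀ U → FollowsShift (M *U U) shift
    follows = *U-followsShift M arrow-follows

    direction-at : ∀ x c → Arrow x c (shift x c) →
      M ⊨ ◇ x ⊤' ∧' ([∀] (◇ x ◇a⊤ ⇒ □ x ◇a⊤)) , c
    direction-at x c r = ◇⊤-intro M r ,ᶜ λ U → ◇⇒□ (M *U U) (follows U) x ◇a⊤ c

    inverse-at : ∀ x y c → shift y (shift x c) ≡ c → ∀ U →
      (M *U U) ⊨ ◇a⊤ , c → (M *U U) ⊨ □ x (□ y ◇a⊤) , c
    inverse-at x y c inverse U = □□-of-inverse (M *U U) (follows U) x y ◇a⊤ c inverse

    commute-at : ∀ x y c → shift y (shift x c) ≡ shift x (shift y c) → ∀ U →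
      (M *U U) ⊨ ◇ x (◇ y ◇a⊤) ⇒ □ y (□ x ◇a⊤) , c
    commute-at x y c commute U = ◇◇⇒□□-of-commuting (M *U U) (follows U) x y ◇a⊤ c commute

    ψgrid-valid : ∀ c → M ⊨ ψgrid , c
    ψgrid-valid c@(i , t) =
      (◇⊤-intro M {a} refl ,ᶜ λ U → □◇⊤-of-fixed (M *U U) (follows U) a c refl)
      ,ᶜ ⋀-map-intro (λ n → □ (other n) ⊥') (allFin k) (λ _ _ ())
      ,ᶜ (direction-at left c refl ,ᶜ direction-at right c refl
          ,ᶜ direction-at up c refl ,ᶜ direction-at down c refl ,ᶜ excluded-middleᶜ)
      ,ᶜ (λ U → ⇒ᶜ-intro λ ◇a⊤-here →
             inverse-at left right c (cong (_, t) (ℤ.suc-pred i)) U ◇a⊤-here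
          ,ᶜ inverse-at right left c (cong (_, t) (ℤ.pred-suc i)) U ◇a⊤-here
          ,ᶜ inverse-at up down c (cong (i ,_) (ℤ.pred-suc t)) U ◇a⊤-here
          ,ᶜ inverse-at down up c (cong (i ,_) (ℤ.suc-pred t)) U ◇a⊤-here
          ,ᶜ excluded-middleᶜ)
      ,ᶜ (λ U → commute-at up left c refl U ,ᶜ commute-at up right c refl U
          ,ᶜ commute-at down left c refl U ,ᶜ commute-at down right c refl U
          ,ᶜ commute-at left up c refl U ,ᶜ commute-at left down c refl U
          ,ᶜ commute-at right up c refl U ,ᶜ commute-at right down c refl U ,ᶜ excluded-middleᶜ)

module Run (T : TM) where
  open TM T

  record Config : Set where
    field
      tape  : ℤ → Fin nΛ
      head  : ℤ
      state : Fin nS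

    scanned : Fin nΛ
    scanned = tape head

  open Config public

  move : Move → ℤ → ℤ
  move mleft   i = ℤ.pred i
  move mremain i = i
  move mright  i = ℤ.suc i

  write : (ℤ → Fin nΛ) → ℤ → Fin nΛ → ℤ → Fin nΛ
  write tape i α j with j ℤ.≟ i
  ... | yes _ = α
  ... | no  _ = tape j

  write-≡ : ∀ tape i α → write tape i α i ≡ α
  write-≡ tape i α with i ℤ.≟ i
  ... | yes _   = refl
  ... | no  i≢i = ⊥-elim (i≢i refl)

  write-≢ : ∀ tape i α j → ¬ j ≡ i → write tape i α j ≡ tape j
  write-≢ tape i α j j≢i with j ℤ.≟ i
  ... | yes j≡i = ⊥-elim (j≢i j≡i)
  ... | no  _   = refl

  step : Config → Config
  step c = record
    { tape  = write (tape c) (head c) (Δ₁ (scanned c) (state c))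
    ; head  = move (Δ₃ (scanned c) (state c)) (head c)
    ; state = Δ₂ (scanned c) (state c)
    }

  run : ℕ → Config
  run zero    = record { tape = λ _ → α₀ ; head = + 0 ; state = s₀ }
  run (suc n) = step (run n)

module RunModel (k : ℕ) (T : TM) (fresh : S₀Fresh T)
    (ι : TMAtom T → ℕ) (ι-injective : Injective _≡_ _≡_ ι) where
  open TM T
  open Run T
  open Logic (Agent k) ℕ
  open Construction k T ι
  open Validity k T ι
  open Grid k

  stateAt : ℤ → Maybe (Fin nS)
  stateAt (+ n)    = just (state (run n))
  stateAt -[1+ _ ] = nothing

  symbolAt : Cell → Fin nΛ
  symbolAt (i , + n)      = tape (run n) i
  symbolAt (_ , -[1+ _ ]) = α₀

  Holds : TMAtom T → Cell → Set
  Holds (st s)  (_ , t)        = stateAt t ≡ s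
  Holds (sym α) c              = symbolAt c ≡ α
  Holds pos     (i , + n)      = i ≡ head (run n)
  Holds lpos    (i , + n)      = i < head (run n)
  Holds rpos    (i , + n)      = head (run n) < i
  Holds _       (_ , -[1+ _ ]) = ⊥

  holds? : ∀ t c → Dec (Holds t c)
  holds? (st s)  (_ , t)        = ≡-dec _≟F_ (stateAt t) s
  holds? (sym α) c              = symbolAt c ≟F α
  holds? pos     (i , + n)      = i ℤ.≟ head (run n)
  holds? lpos    (i , + n)      = i ℤ.<? head (run n)
  holds? rpos    (i , + n)      = head (run n) ℤ.<? i
  holds? pos     (_ , -[1+ _ ]) = no λ ()
  holds? lpos    (_ , -[1+ _ ]) = no λ ()
  holds? rpos    (_ , -[1+ _ ]) = no λ ()

  atoms : List (TMAtom T)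
  atoms = pos ∷ lpos ∷ rpos ∷ map st states ++ map sym symbols

  ∈-states : ∀ s → s ∈ states
  ∈-states nothing  = here refl
  ∈-states (just s) = there (∈-map⁺ just (∈-allFin s))

  ∈-atoms : ∀ t → t ∈ atoms
  ∈-atoms pos     = here refl
  ∈-atoms lpos    = there (here refl)
  ∈-atoms rpos    = there (there (here refl))
  ∈-atoms (st s)  = there (there (there (∈-++⁺ˡ (∈-map⁺ st (∈-states s)))))
  ∈-atoms (sym α) = there (there (there (∈-++⁺ʳ (map st states) (∈-map⁺ sym (∈-allFin α)))))

  Names : ℕ → Cell → TMAtom T → Set
  Names p c t = ι t ≡ p × Holds t c

  names? : ∀ p c t → Dec (Names p c t)
  names? p c t = (ι t ℕ.≟ p) ×-dec holds? t c

  valuation : ℕ → Cell → Bool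
  valuation p c = does (any? (names? p c) atoms)

  Mod : Model
  Mod = grid valuation

  at-intro : ∀ t c → Holds t c → Mod ⊨ at t , c
  at-intro t c h = dec-true (any? (names? (ι t) c) atoms) (lose (∈-atoms t) (refl , h))

  at-elim : ∀ t c → Mod ⊨ at t , c → Holds t c
  at-elim t c h with satisfied (does-true⇒ (any? (names? (ι t) c) atoms) h)
  ... | t′ , ιt′≡ιt , h′ = subst (λ u → Holds u c) (ι-injective ιt′≡ιt) h′

  at-elim-∧ : ∀ t u c → Mod ⊨ at t ∧' at u , c → Holds t c × Holds u c
  at-elim-∧ t u c h = Product.map (at-elim t c) (at-elim u c) (∧ᶜ-elim true-stable true-stable h)

  at-elim-∨ : ∀ t u c → Mod ⊨ at t ∨' at u , c → Holds t c ⊎ Holds u c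
  at-elim-∨ t u c h = Sum.map (at-elim t c) (at-elim u c) (∨ᶜ-elim (_ ≟ᵇ true) true-stable h)

  exclusive : ∀ t u c → (Holds t c → Holds u c → ⊥) → Mod ⊨ ¬' (at t ∧' at u) , c
  exclusive t u c disjoint h = let (ht , hu) = at-elim-∧ t u c h in disjoint ht hu

  pos-lpos-disjoint : ∀ c → Holds pos c → Holds lpos c → ⊥
  pos-lpos-disjoint (_ , + n) refl = ℤ.<-irrefl refl

  pos-rpos-disjoint : ∀ c → Holds pos c → Holds rpos c → ⊥
  pos-rpos-disjoint (_ , + n) refl = ℤ.<-irrefl refl

  rpos-lpos-disjoint : ∀ c → Holds rpos c → Holds lpos c → ⊥
  rpos-lpos-disjoint (_ , + n) = ℤ.<-asym

  rpos-right : ∀ c → Holds pos c ⊎ Holds rpos c → Holds rpos (shift right c)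
  rpos-right (i , + n) (inj₁ refl) = i<suc[i] i
  rpos-right (i , + n) (inj₂ h<i)  = ℤ.<-trans h<i (i<suc[i] i)

  lpos-left : ∀ c → Holds pos c ⊎ Holds lpos c → Holds lpos (shift left c)
  lpos-left (i , + n) (inj₁ refl) = pred[i]<i i
  lpos-left (i , + n) (inj₂ i<h)  = ℤ.<-trans (pred[i]<i i) i<h

  s₀-only-initially : ∀ t → stateAt t ≡ just s₀ → t ≡ + 0
  s₀-only-initially (+ zero)    _  = refl
  s₀-only-initially (+ suc n)   eq = ⊥-elim (fresh _ _ (just-injective eq))
  s₀-only-initially -[1+ _ ]    ()

  void-below : ∀ t → stateAt t ≡ just s₀ ⊎ stateAt t ≡ nothing → stateAt (ℤ.pred t) ≡ nothing
  void-below t (inj₁ eq) rewrite s₀-only-initially t eq = refl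
  void-below -[1+ _ ] (inj₂ _)  = refl
  void-below (+ _)    (inj₂ ())

  symbol-initially : ∀ i t → stateAt t ≡ just s₀ → symbolAt (i , t) ≡ α₀
  symbol-initially i t eq rewrite s₀-only-initially t eq = refl

  symbol-off-head : ∀ i t → ¬ Holds pos (i , t) → symbolAt (i , ℤ.suc t) ≡ symbolAt (i , t)
  symbol-off-head i (+ n)          i≢h = write-≢ _ _ _ i i≢h
  symbol-off-head i -[1+ zero ]    _   = refl
  symbol-off-head i -[1+ suc _ ]   _   = refl

  ψsane-valid : ∀ c → Mod ⊨ ψsane , c
  ψsane-valid c@(i , t) =
      (exclusive pos lpos c (pos-lpos-disjoint c)
        ,ᶜ exclusive pos rpos c (pos-rpos-disjoint c)
        ,ᶜ exclusive rpos lpos c (rpos-lpos-disjoint c))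
    ,ᶜ (⇒ᶜ-intro (λ h → λ { _ refl → at-intro rpos _ (rpos-right c (at-elim-∨ pos rpos c h)) })
        ,ᶜ ⇒ᶜ-intro (λ h → λ { _ refl → at-intro lpos _ (lpos-left c (at-elim-∨ pos lpos c h)) }))
    ,ᶜ exactly-one-intro (≡-dec _≟F_) (λ s → at (st s)) states (stateAt t) (∈-states _)
         (at-intro (st _) c refl) (λ s h → ≡-sym (at-elim (st s) c h))
    ,ᶜ ⋀-map-intro (λ s → at (st s) ⇒ (□ left (at (st s)) ∧' □ right (at (st s)))) states
         (λ s → ⇒ᶜ-intro λ h → (λ { _ refl → at-intro (st s) _ (at-elim (st s) c h) })
                            ,ᶜ (λ { _ refl → at-intro (st s) _ (at-elim (st s) c h) }))
    ,ᶜ exactly-one-intro _≟F_ (λ α → at (sym α)) symbols (symbolAt c) (∈-allFin _)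
         (at-intro (sym _) c refl) (λ α h → ≡-sym (at-elim (sym α) c h))
    ,ᶜ ⇒ᶜ-intro (λ h → λ { _ refl →
         at-intro (st nothing) _ (void-below t (at-elim-∨ (st (just s₀)) (st nothing) c h)) })
    ,ᶜ ⇒ᶜ-intro (λ h → at-intro (sym α₀) c (symbol-initially i t (at-elim (st (just s₀)) c h)))
    ,ᶜ ⋀-map-intro (λ α → ((¬' at pos) ∧' at (sym α)) ⇒ □ up (at (sym α))) symbols
         (λ α → ⇒ᶜ-intro λ h → let (off-head , α-here) = ∧ᶜ-elim negated-stable true-stable h in
            λ { _ refl → at-intro (sym α) _
                  (trans (symbol-off-head i t (off-head ∘ at-intro pos c)) (at-elim (sym α) c α-here)) })
    ,ᶜ excluded-middleᶜ

  data Scanning (α : Fin nΛ) (s : Fin nS) : Cell → Set where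
    scanning-at : ∀ n → scanned (run n) ≡ α → state (run n) ≡ s →
      Scanning α s (head (run n) , + n)

  scanning : ∀ α s c → Mod ⊨ at pos ∧' (at (st (just s)) ∧' at (sym α)) , c → Scanning α s c
  scanning α s c h with ∧ᶜ-elim true-stable negated-stable h
  ... | at-pos , rest with at-elim pos c at-pos | at-elim-∧ (st (just s)) (sym α) c rest
  scanning α s (_ , + n) h | _ | refl | state≡s , scanned≡α =
    scanning-at n scanned≡α (just-injective state≡s)

  head-moves : ∀ {α s m i t} → Δ₃ α s ≡ m → Scanning α s (i , t) → Holds pos (move m i , ℤ.suc t)
  head-moves refl (scanning-at n refl refl) = refl

  state-steps : ∀ {α s c} → Scanning α s c → Mod ⊨ □ up (at (st (just (Δ₂ α s)))) , c
  state-steps (scanning-at n refl refl) _ refl = at-intro (st _) _ refl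

  symbol-steps : ∀ {α s c} → Scanning α s c → Mod ⊨ □ up (at (sym (Δ₁ α s))) , c
  symbol-steps (scanning-at n refl refl) _ refl = at-intro (sym _) _ (write-≡ (tape (run n)) (head (run n)) _)

  move-valid : ∀ α s c → Mod ⊨ moveClause α s , c
  move-valid α s c@(i , t) with Δ₃ α s in moves
  ... | mleft   = ⇒ᶜ-intro λ h → λ { _ refl _ refl → at-intro pos _ (head-moves moves (scanning α s c h)) }
  ... | mright  = ⇒ᶜ-intro λ h → λ { _ refl _ refl → at-intro pos _ (head-moves moves (scanning α s c h)) }
  ... | mremain = ⇒ᶜ-intro λ h → λ { _ refl → at-intro pos _ (head-moves moves (scanning α s c h)) }

  transition-valid : ∀ α s c → Mod ⊨ transClauses α s , c
  transition-valid α s c =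
    move-valid α s c ,ᶜ ⇒ᶜ-intro (state-steps ∘ scanning α s c) ,ᶜ ⇒ᶜ-intro (symbol-steps ∘ scanning α s c)

  ψT-valid : ∀ c → Mod ⊨ ψT , c
  ψT-valid c = ⋀-intro _ transition
    where
    transition : ∀ {φ} → φ ∈ concatMap (λ α → map (transClauses α) (allFin nS)) symbols → Mod ⊨ φ , c
    transition φ∈ with satisfied (∈-concatMap⁻ _ {xs = symbols} φ∈)
    ... | α , φ∈α with ∈-map⁻ (transClauses α) φ∈α
    ... | s , _ , refl = transition-valid α s c

  origin : Cell
  origin = + 0 , + 0

  φT-holds : Mod ⊨ φT , origin
  φT-holds = (λ c _ → ψgrid-valid T ι valuation c) ,ᶜ (λ c _ → ψsane-valid c) ,ᶜ (λ c _ → ψT-valid c)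
    ,ᶜ at-intro (st (just s₀)) origin refl ,ᶜ at-intro pos origin refl

lemma1 : (k : ℕ) (T : TM) → S₀Fresh T →
    (ι : TMAtom T → ℕ) → Injective _≡_ _≡_ ι →
    Σ (Logic.Model (Agent k) ℕ) λ M →
      Σ (Logic.Model.W M) λ w →
        Logic._⊨_,_ (Agent k) ℕ M (Construction.φT k T ι) w
lemma1 k T fresh ι ι-injective = Mod , origin , φT-holds
  where open RunModel k T fresh ι ι-injective
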